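{- Let $\ell\ge1$ and $k\ge2$ be integers. The vertex set $V^\ell_k$ of $ST^\ell_k$ admits a partition into the $k$ E$^\ell$-sets $S_i^k=\{v_0v_1\cdots v_{k\ell-1}\in V^\ell_k : v_0=i\}$, $i\in[k]$.
   Context: $[k]=\{0,\ldots,k-1\}$. $V^\ell_k$ is the set of all strings of length $k\ell$ over $[k]$ containing exactly $\ell$ occurrences of each symbol of $[k]$. The graph $ST^\ell_k$ has vertex set $V^\ell_k$, with $v=v_0\cdots v_{k\ell-1}$ adjacent to $w$ iff $w$ is obtained from $v$ by swapping the first entry $v_0$ with some entry $v_j$ ($1\le j\le k\ell-1$) such that $v_j\neq v_0$. A set $S$ of vertices of a graph $G$ is an E$^\ell$-set if every vertex of $V(G)\setminus S$ is adjacent to exactly $\ell$ vertices of $S$. -}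

module Defs where

open import Data.Nat using (ℕ; _*_)
open import Data.Fin using (Fin; toℕ; _≟_)
open import Data.List using (length; filter)
open import Data.Product using (Σ; _×_; ∃; ∃-syntax)
open import Relation.Binary.PropositionalEquality using (_≡_; _≢_)
open import Relation.Nullary using (¬_)
import Data.List.Base as L

Word : ℕ → ℕ → Set
Word k n = Fin n → Fin k

_≈_ : ∀ {k n} → Word k n → Word k n → Set
v ≈ w = ∀ p → v p ≡ w p

count : ∀ {k n} → Word k n → Fin k → ℕ
count {n = n} v i = length (filter (λ p → v p ≟ i) (L.allFin n))

InV : (k ℓ : ℕ) → Word k (k * ℓ) → Set
InV k ℓ v = ∀ (i : Fin k) → count v i ≡ ℓ

swap : ∀ {n} → Fin n → Fin n → Fin n → Fin n
swap i j p with p ≟ i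
... | Relation.Nullary.yes _ = j
... | Relation.Nullary.no _ with p ≟ j
...   | Relation.Nullary.yes _ = i
...   | Relation.Nullary.no _ = p

Adj : ∀ {k n} → Word k n → Word k n → Set
Adj {n = n} v w =
  Σ (Fin n) λ z → Σ (Fin n) λ j →
    (toℕ z ≡ 0) × (toℕ j ≢ 0) × (v j ≢ v z) × (∀ p → w p ≡ v (swap z j p))

FirstIs : ∀ {k n} → Word k n → Fin k → Set
FirstIs {n = n} v i = Σ (Fin n) λ z → (toℕ z ≡ 0) × (v z ≡ i)

S : (k ℓ : ℕ) → Fin k → Word k (k * ℓ) → Set
S k ℓ i v = InV k ℓ v × FirstIs v i

-- v has exactly m neighbours (in ST^ℓ_k) lying in the vertex set P:
-- there is an injective enumeration by Fin m of them, hitting all of them.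
ExactlyNbrsIn : (k ℓ m : ℕ) → (Word k (k * ℓ) → Set) → Word k (k * ℓ) → Set
ExactlyNbrsIn k ℓ m P v =
  Σ (Fin m → Word k (k * ℓ)) λ f →
      (∀ a → InV k ℓ (f a) × P (f a) × Adj v (f a))
    × (∀ a b → f a ≈ f b → a ≡ b)
    × (∀ w → InV k ℓ w → P w → Adj v w → ∃[ a ] (w ≈ f a))

IsEℓSet : (k ℓ : ℕ) → (Word k (k * ℓ) → Set) → Set
IsEℓSet k ℓ P = ∀ v → InV k ℓ v → ¬ P v → ExactlyNbrsIn k ℓ ℓ P v

{-# OPTIONS --safe #-}
module Submission where

-- Every vertex v lies in exactly one class, S_{v₀}. If v₀ ≠ i, the neighbours of v
-- in S_i are exactly the words obtained by swapping v₀ with one of the ℓ occurrences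
-- of i in v, and different occurrences give different neighbours; swapping preserves
-- symbol counts, so these neighbours are vertices. A vertex of S_i is obtained from
-- the block word 0^ℓ 1^ℓ … (k-1)^ℓ by swapping an occurrence of i to the front.
-- Counts are handled through bijections between Fin m and the positions of a symbol,
-- so that their invariance under swapping is just composition with an involution.

open import Defs
open import Data.Nat using (ℕ; _≤_; _*_; suc)
open import Data.Fin using (Fin; toℕ; _≟_; fromℕ<; combine; quotient; remainder)
import Data.Fin as Fin
open import Data.Fin.Properties using (toℕ-injective; remQuot-combine; combine-remQuot; combine-injectiveʳ)
open import Data.Fin.Permutation using (↔⇒≡)
open import Data.Product using (_×_; ∃-syntax; _,_; proj₁; proj₂)
open import Data.Empty using (⊥-elim)
open import Data.List using (List; lookup; filter; allFin)
open import Data.List.Relation.Unary.All using () renaming (lookup to All-lookup)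
open import Data.List.Relation.Unary.AllPairs using (_∷_)
open import Data.List.Relation.Unary.Any using (index)
open import Data.List.Relation.Unary.Any.Properties using (lookup-index)
open import Data.List.Relation.Unary.Unique.Propositional using (Unique)
open import Data.List.Relation.Unary.Unique.Propositional.Properties using (allFin⁺; filter⁺)
open import Data.List.Membership.Propositional.Properties using (∈-filter⁺; ∈-filter⁻; ∈-lookup; ∈-allFin)
open import Function.Bundles using (mk↔ₛ′)
open import Relation.Binary.PropositionalEquality
  using (_≡_; _≢_; refl; sym; trans; cong; subst; module ≡-Reasoning)
open import Relation.Nullary using (Dec; yes; no)

lookup-injective : ∀ {A : Set} {xs : List A} → Unique xs →
                   ∀ {a b} → lookup xs a ≡ lookup xs b → a ≡ b
lookup-injective (_  ∷ _) {Fin.zero}  {Fin.zero}  _ = refl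
lookup-injective (x∉ ∷ _) {Fin.zero}  {Fin.suc b} e = ⊥-elim (All-lookup x∉ (∈-lookup b) e)
lookup-injective (x∉ ∷ _) {Fin.suc a} {Fin.zero}  e = ⊥-elim (All-lookup x∉ (∈-lookup a) (sym e))
lookup-injective (_  ∷ u) {Fin.suc a} {Fin.suc b} e = cong Fin.suc (lookup-injective u e)

record Occurrences {k n : ℕ} (v : Word k n) (i : Fin k) (m : ℕ) : Set where
  field
    position           : Fin m → Fin n
    symbol-at          : ∀ a → v (position a) ≡ i
    position-injective : ∀ {a b} → position a ≡ position b → a ≡ b
    position-onto      : ∀ p → v p ≡ i → ∃[ a ] position a ≡ p

open Occurrences

occurrences-count : ∀ {k n} (v : Word k n) i → Occurrences v i (count v i)
occurrences-count {n = n} v i = record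
  { position           = lookup holders
  ; symbol-at          = λ a → proj₂ (∈-filter⁻ holds? {xs = allFin n} (∈-lookup a))
  ; position-injective = lookup-injective (filter⁺ holds? (allFin⁺ n))
  ; position-onto      = λ p vp≡i →
      let p∈ = ∈-filter⁺ holds? (∈-allFin p) vp≡i in index p∈ , sym (lookup-index p∈)
  }
  where
  holds? : ∀ p → Dec (v p ≡ i)
  holds? p = v p ≟ i

  holders : List (Fin n)
  holders = filter holds? (allFin n)

module _ {k n : ℕ} {v : Word k n} {i : Fin k} where

  transfer : ∀ {m m′} → Occurrences v i m → Occurrences v i m′ → Fin m → Fin m′
  transfer o o′ a = proj₁ (position-onto o′ (position o a) (symbol-at o a))

  position-transfer : ∀ {m m′} (o : Occurrences v i m) (o′ : Occurrences v i m′) a →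
                      position o′ (transfer o o′ a) ≡ position o a
  position-transfer o o′ a = proj₂ (position-onto o′ (position o a) (symbol-at o a))

  transfer-inverse : ∀ {m m′} (o : Occurrences v i m) (o′ : Occurrences v i m′) b →
                     transfer o o′ (transfer o′ o b) ≡ b
  transfer-inverse o o′ b =
    position-injective o′ (trans (position-transfer o o′ _) (position-transfer o′ o b))

  occurrences-unique : ∀ {m m′} → Occurrences v i m → Occurrences v i m′ → m ≡ m′
  occurrences-unique o o′ =
    ↔⇒≡ (mk↔ₛ′ (transfer o o′) (transfer o′ o) (transfer-inverse o o′) (transfer-inverse o′ o))

  count-occurrences : ∀ {m} → Occurrences v i m → count v i ≡ m
  count-occurrences = occurrences-unique (occurrences-count v i)

  occurrences-∘-involution : ∀ {m} (σ : Fin n → Fin n) → (∀ p → σ (σ p) ≡ p) →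
                             Occurrences v i m → Occurrences (λ p → v (σ p)) i m
  occurrences-∘-involution σ σσ≗id o = record
    { position           = λ a → σ (position o a)
    ; symbol-at          = λ a → trans (cong v (σσ≗id _)) (symbol-at o a)
    ; position-injective = λ e →
        position-injective o (trans (sym (σσ≗id _)) (trans (cong σ e) (σσ≗id _)))
    ; position-onto      = λ p vσp≡i →
        let (a , e) = position-onto o (σ p) vσp≡i in a , trans (cong σ e) (σσ≗id p)
    }

InV⇒occurrences : ∀ {k ℓ} {v : Word k (k * ℓ)} → InV k ℓ v → ∀ i → Occurrences v i ℓ
InV⇒occurrences {v = v} inv i = subst (Occurrences v i) (inv i) (occurrences-count v i)

swap-matchˡ : ∀ {n} (i j : Fin n) → swap i j i ≡ j
swap-matchˡ i j with i ≟ i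
... | yes _   = refl
... | no i≢i = ⊥-elim (i≢i refl)

swap-matchʳ : ∀ {n} (i j : Fin n) → swap i j j ≡ i
swap-matchʳ i j with j ≟ i
... | yes j≡i = j≡i
... | no _ with j ≟ j
...   | yes _   = refl
...   | no j≢j = ⊥-elim (j≢j refl)

swap-mismatch : ∀ {n} {i j p : Fin n} → p ≢ i → p ≢ j → swap i j p ≡ p
swap-mismatch {i = i} {j} {p} p≢i p≢j with p ≟ i
... | yes p≡i = ⊥-elim (p≢i p≡i)
... | no _ with p ≟ j
...   | yes p≡j = ⊥-elim (p≢j p≡j)
...   | no _    = refl

swap-involutive : ∀ {n} (i j p : Fin n) → swap i j (swap i j p) ≡ p
swap-involutive i j p = by-cases (p ≟ i) (p ≟ j)
  where
  fixes : ∀ {q} → swap i j (swap i j q) ≡ q → p ≡ q → swap i j (swap i j p) ≡ p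
  fixes e p≡q = subst (λ x → swap i j (swap i j x) ≡ x) (sym p≡q) e

  by-cases : Dec (p ≡ i) → Dec (p ≡ j) → swap i j (swap i j p) ≡ p
  by-cases (yes p≡i) _ = fixes (trans (cong (swap i j) (swap-matchˡ i j)) (swap-matchʳ i j)) p≡i
  by-cases _ (yes p≡j) = fixes (trans (cong (swap i j) (swap-matchʳ i j)) (swap-matchˡ i j)) p≡j
  by-cases (no p≢i) (no p≢j) =
    trans (cong (swap i j) (swap-mismatch p≢i p≢j)) (swap-mismatch p≢i p≢j)

InV-swap : ∀ {k ℓ} {v : Word k (k * ℓ)} (i j : Fin (k * ℓ)) →
           InV k ℓ v → InV k ℓ (λ p → v (swap i j p))
InV-swap i j inv s =
  count-occurrences (occurrences-∘-involution (swap i j) (swap-involutive i j) (InV⇒occurrences inv s))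

quotient-occurrences : ∀ {k} ℓ (i : Fin k) → Occurrences (quotient ℓ) i ℓ
quotient-occurrences {k} ℓ i = record
  { position           = combine i
  ; symbol-at          = λ a → cong proj₁ (remQuot-combine i a)
  ; position-injective = combine-injectiveʳ i _ i _
  ; position-onto      = λ p qp≡i →
      remainder {k} ℓ p , subst (λ x → combine x (remainder {k} ℓ p) ≡ p) qp≡i (combine-remQuot {k} ℓ p)
  }

quotient-InV : ∀ k ℓ → InV k ℓ (quotient ℓ)
quotient-InV k ℓ i = count-occurrences (quotient-occurrences ℓ i)

module FirstPosition {k ℓ : ℕ} (z : Fin (k * ℓ)) (z≡0 : toℕ z ≡ 0) where

  first-unique : ∀ {p} → toℕ p ≡ 0 → p ≡ z
  first-unique p≡0 = toℕ-injective (trans p≡0 (sym z≡0))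

  S⇒first : ∀ {i v} → S k ℓ i v → v z ≡ i
  S⇒first {i} {v} (_ , p , p≡0 , vp≡i) = subst (λ q → v q ≡ i) (first-unique p≡0) vp≡i

  S-intro : ∀ {i v} → InV k ℓ v → v z ≡ i → S k ℓ i v
  S-intro inv vz≡i = inv , z , z≡0 , vz≡i

  Adj-swap : ∀ {v : Word k (k * ℓ)} {j} → toℕ j ≢ 0 → v j ≢ v z → Adj v (λ p → v (swap z j p))
  Adj-swap j≢0 vj≢vz = z , _ , z≡0 , j≢0 , vj≢vz , λ _ → refl

  Adj⇒swap : ∀ {v w : Word k (k * ℓ)} → Adj v w → ∃[ j ] w ≈ (λ p → v (swap z j p))
  Adj⇒swap {v} {w} (z′ , j , z′≡0 , _ , _ , w≈) =
    j , subst (λ y → w ≈ (λ p → v (swap y j p))) (first-unique z′≡0) w≈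

  S-nonempty : 1 ≤ ℓ → ∀ i → ∃[ v ] S k ℓ i v
  S-nonempty 1≤ℓ i = _ , S-intro (InV-swap z j (quotient-InV k ℓ))
                               (trans (cong (quotient ℓ) (swap-matchˡ z j)) (symbol-at o _))
    where
    o : Occurrences (quotient ℓ) i ℓ
    o = quotient-occurrences ℓ i

    j : Fin (k * ℓ)
    j = position o (fromℕ< 1≤ℓ)

  S-IsEℓSet : ∀ i → IsEℓSet k ℓ (S k ℓ i)
  S-IsEℓSet i v inv v∉Sᵢ = neighbour , neighbour-valid , neighbour-injective , neighbour-onto
    where
    o : Occurrences v i ℓ
    o = InV⇒occurrences inv i

    vz≢i : v z ≢ i
    vz≢i vz≡i = v∉Sᵢ (S-intro inv vz≡i)

    position≢z : ∀ a → position o a ≢ z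
    position≢z a e = vz≢i (trans (cong v (sym e)) (symbol-at o a))

    neighbour : Fin ℓ → Word k (k * ℓ)
    neighbour a p = v (swap z (position o a) p)

    neighbour-valid : ∀ a → InV k ℓ (neighbour a) × S k ℓ i (neighbour a) × Adj v (neighbour a)
    neighbour-valid a =
      InV-swap z (position o a) inv ,
      S-intro (InV-swap z (position o a) inv) (trans (cong v (swap-matchˡ z (position o a))) (symbol-at o a)) ,
      Adj-swap (λ e → position≢z a (first-unique e)) (λ e → vz≢i (trans (sym e) (symbol-at o a)))

    -- At the a-th occurrence, neighbour a shows v z ≢ i, while any other neighbour shows i.
    neighbour-injective : ∀ a b → neighbour a ≈ neighbour b → a ≡ b
    neighbour-injective a b na≈nb with position o a ≟ position o b
    ... | yes e = position-injective o e
    ... | no pa≢pb = ⊥-elim (vz≢i (begin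
      v z                      ≡⟨ cong v (swap-matchʳ z (position o a)) ⟨
      neighbour a (position o a) ≡⟨ na≈nb (position o a) ⟩
      neighbour b (position o a) ≡⟨ cong v (swap-mismatch (position≢z a) pa≢pb) ⟩
      v (position o a)           ≡⟨ symbol-at o a ⟩
      i                        ∎))
      where open ≡-Reasoning

    neighbour-onto : ∀ w → InV k ℓ w → S k ℓ i w → Adj v w → ∃[ a ] (w ≈ neighbour a)
    neighbour-onto w _ w∈Sᵢ v~w =
      a , λ p → trans (w≈ p) (cong (λ y → v (swap z y p)) (sym pa≡j))
      where
      j : Fin (k * ℓ)
      j = proj₁ (Adj⇒swap v~w)

      w≈ : w ≈ (λ p → v (swap z j p))
      w≈ = proj₂ (Adj⇒swap v~w)

      vj≡i : v j ≡ i
      vj≡i = trans (cong v (sym (swap-matchˡ z j))) (trans (sym (w≈ z)) (S⇒first w∈Sᵢ))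

      a : Fin ℓ
      a = proj₁ (position-onto o j vj≡i)

      pa≡j : position o a ≡ j
      pa≡j = proj₂ (position-onto o j vj≡i)

  S-cover : ∀ v → InV k ℓ v → ∃[ i ] S k ℓ i v
  S-cover v inv = v z , S-intro inv refl

  S-disjoint : ∀ (i j : Fin k) v → S k ℓ i v → S k ℓ j v → i ≡ j
  S-disjoint i j v v∈Sᵢ v∈Sⱼ = trans (sym (S⇒first v∈Sᵢ)) (S⇒first v∈Sⱼ)

corollary2 : (ℓ k : ℕ) → 1 ≤ ℓ → 2 ≤ k →
    -- each S_i is nonempty and an E^ℓ-set
    (∀ (i : Fin k) → (∃[ v ] S k ℓ i v) × IsEℓSet k ℓ (S k ℓ i))
    -- the S_i cover V^ℓ_k
    × (∀ v → InV k ℓ v → ∃[ i ] S k ℓ i v)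
    -- the S_i are pairwise disjoint
    × (∀ (i j : Fin k) v → S k ℓ i v → S k ℓ j v → i ≡ j)
corollary2 (suc ℓ) (suc k) 1≤ℓ _ =
  (λ i → S-nonempty 1≤ℓ i , S-IsEℓSet i) , S-cover , S-disjoint
  where open FirstPosition {suc k} {suc ℓ} Fin.zero refl
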